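{- Let $\mathcal L$ be a combined LTSI satisfying BTI and PCI. Then $\mathcal L$ satisfies Independence of Diamonds: whenever $t:P\xrightarrow{\alpha}Q$, $u:P\xrightarrow{\beta}R$, $u':Q\xrightarrow{\beta}S$, $t':R\xrightarrow{\alpha}S$ are transitions such that $Q\neq R$ if $\alpha,\beta$ are both forward labels or both reverse labels, and $P\neq S$ otherwise, then $t\,\iota\,u$.
   Context: Setting. $\mathrm{Lab}$ is a set of labels and $\overline{\mathrm{Lab}}=\{\overline a: a\in\mathrm{Lab}\}$ a disjoint copy (reverse labels), with $\overline{\overline a}=a$. A combined LTSI $(\mathrm{Proc},\mathrm{Lab},\to,\iota)$ consists of a set $\mathrm{Proc}$ of processes, a set of forward transitions $(P,a,Q)$ with $a\in\mathrm{Lab}$ (forward labels), the set $\to$ of all transitions, consisting of the forward transitions together with, for each forward transition $(P,a,Q)$, the backward transition $(Q,\overline a,P)$ (reverse label $\overline a$), and an irreflexive symmetric relation $\iota$ on transitions. Write $t:P\xrightarrow{\alpha}Q$ for $t=(P,\alpha,Q)$ and $\overline t=(Q,\overline\alpha,P)$. BTI: any two distinct backward transitions with the same source are independent. PCI: if $t:P\xrightarrow{\alpha}Q$, $u:P\xrightarrow{\beta}R$, $u':Q\xrightarrow{\beta}S$, $t':R\xrightarrow{\alpha}S$ and $t\,\iota\,u$, then $u'\,\iota\,\overline t$. -}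

module Defs where

open import Level using (Level; _⊔_; suc)
open import Relation.Binary.PropositionalEquality using (_≡_)
open import Relation.Nullary using (¬_)
open import Data.Unit using (⊤)
open import Data.Empty using (⊥)

data Dir {ℓ : Level} (Lab : Set ℓ) : Set ℓ where
  fwd : Lab → Dir Lab
  rev : Lab → Dir Lab

bar : ∀ {ℓ} {Lab : Set ℓ} → Dir Lab → Dir Lab
bar (fwd a) = rev a
bar (rev a) = fwd a

SameDir : ∀ {ℓ} {Lab : Set ℓ} → Dir Lab → Dir Lab → Set
SameDir (fwd _) (fwd _) = ⊤
SameDir (rev _) (rev _) = ⊤
SameDir (fwd _) (rev _) = ⊥
SameDir (rev _) (fwd _) = ⊥

record Triple {p l : Level} (Proc : Set p) (Lab : Set l) : Set (p ⊔ l) where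
  constructor tr
  field
    src : Proc
    lbl : Dir Lab
    tgt : Proc
open Triple public

rev-tr : ∀ {p l} {Proc : Set p} {Lab : Set l} → Triple Proc Lab → Triple Proc Lab
rev-tr (tr P α Q) = tr Q (bar α) P

record CombinedLTSI (p l r : Level) : Set (suc (p ⊔ l ⊔ r)) where
  field
    Proc : Set p
    Lab  : Set l
    _─[_]→_ : Proc → Lab → Proc → Set r
    _ι_ : Triple Proc Lab → Triple Proc Lab → Set r
    ι-irrefl : ∀ t → ¬ (t ι t)
    ι-sym    : ∀ t u → t ι u → u ι t

  IsTrans : Triple Proc Lab → Set r
  IsTrans (tr P (fwd a) Q) = P ─[ a ]→ Q
  IsTrans (tr P (rev a) Q) = Q ─[ a ]→ P

  IsBackward : Triple Proc Lab → Set
  IsBackward (tr _ (fwd _) _) = ⊥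
  IsBackward (tr _ (rev _) _) = ⊤

  BTI : Set (p ⊔ l ⊔ r)
  BTI = ∀ (t u : Triple Proc Lab) → IsTrans t → IsTrans u →
        IsBackward t → IsBackward u → src t ≡ src u → ¬ (t ≡ u) → t ι u

  PCI : Set (p ⊔ l ⊔ r)
  PCI = ∀ (P Q R S : Proc) (α β : Dir Lab) →
        IsTrans (tr P α Q) → IsTrans (tr P β R) →
        IsTrans (tr Q β S) → IsTrans (tr R α S) →
        tr P α Q ι tr P β R → tr Q β S ι rev-tr (tr P α Q)

  IndependenceOfDiamonds : Set (p ⊔ l ⊔ r)
  IndependenceOfDiamonds = ∀ (P Q R S : Proc) (α β : Dir Lab) →
        IsTrans (tr P α Q) → IsTrans (tr P β R) →
        IsTrans (tr Q β S) → IsTrans (tr R α S) →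
        (SameDir α β → ¬ (Q ≡ R)) → (¬ SameDir α β → ¬ (P ≡ S)) →
        tr P α Q ι tr P β R

-- Around a diamond, PCI carries independence from one corner to the next, and BTI makes
-- two backward transitions with distinct targets independent. Whatever the directions
-- of α and β, some corner of the diamond has both of its transitions backward, and the
-- side condition of ID says exactly that their targets differ; so independence holds
-- there and PCI transports it back to P.
module Submission where

open import Level using (Level)
open import Data.Unit using (tt)
open import Function using (_∘_)
open import Relation.Binary.PropositionalEquality using (_≡_; refl; sym; cong)
open import Relation.Nullary using (¬_)
open import Defs

module Diamonds {p l r : Level} (L : CombinedLTSI p l r) where
  open CombinedLTSI L

  private variable
    P Q R S : Proc
    α β : Dir Lab
    a b : Lab

  IsTrans-rev : ∀ x → IsTrans x → IsTrans (rev-tr x)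
  IsTrans-rev (tr _ (fwd _) _) t = t
  IsTrans-rev (tr _ (rev _) _) t = t

  record Diamond (P Q R S : Proc) (α β : Dir Lab) : Set r where
    field
      t  : IsTrans (tr P α Q)
      u  : IsTrans (tr P β R)
      u′ : IsTrans (tr Q β S)
      t′ : IsTrans (tr R α S)

  mirror : Diamond P Q R S α β → Diamond P R Q S β α
  mirror d = record { t = u ; u = t ; u′ = t′ ; t′ = u′ }
    where open Diamond d

  turn : Diamond P Q R S α β → Diamond Q P S R (bar α) β
  turn {P} {Q} {R} {S} {α} d = record
    { t = IsTrans-rev (tr P α Q) t ; u = u′ ; u′ = u ; t′ = IsTrans-rev (tr R α S) t′ }
    where open Diamond d

  pci-turn : PCI → Diamond P Q R S α β →
             tr P α Q ι tr P β R → tr Q (bar α) P ι tr Q β S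
  pci-turn pci d i = ι-sym _ _ (pci _ _ _ _ _ _ t u u′ t′ i)
    where open Diamond d

  bti-fork : BTI → IsTrans (tr P (rev a) Q) → IsTrans (tr P (rev b) R) →
             ¬ Q ≡ R → tr P (rev a) Q ι tr P (rev b) R
  bti-fork bti t u Q≢R = bti _ _ t u tt tt refl (Q≢R ∘ cong tgt)

  fwd-rev-ι : BTI → PCI → Diamond P Q R S (fwd a) (rev b) →
              ¬ P ≡ S → tr P (fwd a) Q ι tr P (rev b) R
  fwd-rev-ι bti pci d P≢S = pci-turn pci (turn d) (bti-fork bti t u P≢S)
    where open Diamond (turn d)

  diamond-ι : BTI → PCI → Diamond P Q R S α β →
              (SameDir α β → ¬ Q ≡ R) → (¬ SameDir α β → ¬ P ≡ S) →
              tr P α Q ι tr P β R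
  diamond-ι {α = rev _} {rev _} bti pci d Q≢R _ = bti-fork bti t u (Q≢R tt)
    where open Diamond d
  diamond-ι {α = fwd _} {rev _} bti pci d _ P≢S = fwd-rev-ι bti pci d (P≢S λ ())
  diamond-ι {α = rev _} {fwd _} bti pci d _ P≢S =
    ι-sym _ _ (fwd-rev-ι bti pci (mirror d) (P≢S λ ()))
  diamond-ι {P} {Q} {R} {S} {fwd a} {fwd b} bti pci d Q≢R _ =
    ι-sym _ _ (pci-turn pci atR (ι-sym _ _ (fwd-rev-ι bti pci (mirror atR) R≢Q)))
    where
      -- both backward transitions sit at S, which is the backward-backward corner of atR's mirror
      atR : Diamond R P S Q (rev b) (fwd a)
      atR = turn (mirror d)
      R≢Q : ¬ R ≡ Q
      R≢Q = Q≢R tt ∘ sym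

proposition4p10 : ∀ {p l r : Level} (L : CombinedLTSI p l r) →
    CombinedLTSI.BTI L → CombinedLTSI.PCI L →
    CombinedLTSI.IndependenceOfDiamonds L
proposition4p10 L bti pci P Q R S α β t u u′ t′ =
  diamond-ι bti pci (record { t = t ; u = u ; u′ = u′ ; t′ = t′ })
  where open Diamonds L
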